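{- Let $G$ be a connected graph of diameter $D$. Then $\tau_s(G)$ equals the minimum cardinality of a set $W\subseteq V(G)$ for which there is a $W$-resolved embedding $\varphi$ of $G$ in $P_{D+1}^{\boxtimes,|W|}$ such that $\varphi(G)$ is an isometric subgraph of $P_{D+1}^{\boxtimes,|W|}$.
   Context: For vertices $u,v,w$ of a connected graph, $w$ strongly resolves $u,v$ if there is a shortest $u$-$w$ path containing $v$ or a shortest $v$-$w$ path containing $u$. A strong resolving set is a set $W$ such that every pair of vertices is strongly resolved by some vertex of $W$; the strong dimension $\beta_s(G)$ is the minimum size of a strong resolving set. $\mathcal{U}(G)$ is the family of graphs having $G$ as spanning subgraph, and the threshold strong dimension is $\tau_s(G)=\min\{\beta_s(H):H\in\mathcal{U}(G)\}$. $P_n$ is the path on $\{0,\dots,n-1\}$ with $i\sim i+1$; $G^{\boxtimes,k}$ is the strong product of $k$ copies of $G$ (distinct tuples adjacent iff equal or adjacent in every coordinate), so in $P_n^{\boxtimes,k}$, $d(x,y)=\max_i|x_i-y_i|$. An embedding is an injective edge-preserving map $\varphi$; $\varphi(G)$ is the subgraph induced by $\varphi(V(G))$. For $W=\{w_1,\dots,w_k\}$, a $W$-resolved embedding of $G$ in $P^{\boxtimes,k}$ is an embedding with $\varphi(x)=\big(d_{\varphi(G)}(\varphi(x),\varphi(w_1)),\dots,d_{\varphi(G)}(\varphi(x),\varphi(w_k))\big)$ for all $x$. A subgraph is isometric if it preserves all distances. -}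

module Defs where

open import Level using (Level)
open import Data.Nat using (ℕ; zero; suc; _≤_)
open import Data.Nat.Properties using (suc-injective)
open import Data.Fin using (Fin; toℕ)
open import Data.Fin.Properties using (all?) renaming (_≟_ to _≟F_)
open import Data.Nat.Properties renaming (_≟_ to _≟ℕ_) using ()
open import Data.Vec using (Vec; lookup)
open import Data.Vec.Properties using (≡-dec)
open import Data.Product using (Σ; ∃; _×_; _,_)
open import Data.Sum using (_⊎_; inj₁; inj₂)
open import Relation.Nullary using (¬_; Dec)
open import Relation.Nullary.Decidable using (_×-dec_; _⊎-dec_; ¬?)
open import Relation.Binary.Definitions using (DecidableEquality)
open import Relation.Binary.PropositionalEquality using (_≡_; _≢_; refl; sym)
open import Function.Definitions using (Injective)

record Graph (V : Set) : Set₁ where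
  field
    _~_      : V → V → Set
    ~-sym    : ∀ {u v} → u ~ v → v ~ u
    ~-irrefl : ∀ {v} → ¬ (v ~ v)
    _~?_     : ∀ u v → Dec (u ~ v)
open Graph public

data Walk {V : Set} (G : Graph V) : V → V → ℕ → Set where
  []  : ∀ {u} → Walk G u u 0
  _∷_ : ∀ {u v w k} → _~_ G u v → Walk G v w k → Walk G u w (suc k)

data _∈W_ {V : Set} {G : Graph V} (x : V) : ∀ {u w k} → Walk G u w k → Set where
  here  : ∀ {w k} {p : Walk G x w k} → x ∈W p
  there : ∀ {u v w k} {e : _~_ G u v} {p : Walk G v w k} → x ∈W p → x ∈W (e ∷ p)

Dist : {V : Set} → Graph V → V → V → ℕ → Set
Dist G u v d = Walk G u v d × (∀ m → Walk G u v m → d ≤ m)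

Connected : {V : Set} → Graph V → Set
Connected G = ∀ u v → ∃ λ d → Walk G u v d

IsDiameter : {V : Set} → Graph V → ℕ → Set
IsDiameter G D = (Σ _ λ u → Σ _ λ v → Dist G u v D) × (∀ u v d → Dist G u v d → d ≤ D)

-- there is a shortest u-w path containing v  (a shortest walk is a path)
ShortestPathThrough : {V : Set} → Graph V → V → V → V → Set
ShortestPathThrough G u w v =
  Σ ℕ λ d → Σ (Walk G u w d) λ p → (∀ m → Walk G u w m → d ≤ m) × v ∈W p

StronglyResolves : {V : Set} → Graph V → V → V → V → Set
StronglyResolves G w u v = ShortestPathThrough G u w v ⊎ ShortestPathThrough G v w u

-- W = {W 0, ..., W (k-1)} (W injective) is a strong resolving set
IsStrongResolvingSet : {V : Set} → Graph V → ∀ {k} → (Fin k → V) → Set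
IsStrongResolvingSet G W = ∀ u v → u ≢ v → ∃ λ i → StronglyResolves G (W i) u v

IsMin : ∀ {ℓ} → (ℕ → Set ℓ) → ℕ → Set ℓ
IsMin P m = P m × (∀ k → P k → m ≤ k)

StrongDim : {V : Set} → Graph V → ℕ → Set
StrongDim {V} G b =
  IsMin (λ k → Σ (Fin k → V) λ W → Injective _≡_ _≡_ W × IsStrongResolvingSet G W) b

_⊆G_ : {V : Set} → Graph V → Graph V → Set
G ⊆G H = ∀ {u v} → _~_ G u v → _~_ H u v

ThresholdStrongDim : {V : Set} → Graph V → ℕ → Set₁
ThresholdStrongDim {V} G t =
  IsMin (λ k → Σ (Graph V) λ H → G ⊆G H × StrongDim H k) t

Path : (m : ℕ) → Graph (Fin m)
Path m = record
  { _~_ = λ i j → toℕ j ≡ suc (toℕ i) ⊎ toℕ i ≡ suc (toℕ j)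
  ; ~-sym = λ { (inj₁ e) → inj₂ e ; (inj₂ e) → inj₁ e }
  ; ~-irrefl = λ { (inj₁ e) → n≢sn e ; (inj₂ e) → n≢sn e }
  ; _~?_ = λ i j → (toℕ j ≟ℕ suc (toℕ i)) ⊎-dec (toℕ i ≟ℕ suc (toℕ j))
  }
  where
  n≢sn : ∀ {n} → n ≢ suc n
  n≢sn {zero} ()
  n≢sn {suc n} e = n≢sn (suc-injective e)

StrongPower : {V : Set} → DecidableEquality V → Graph V → (k : ℕ) → Graph (Vec V k)
StrongPower {V} _≟_ G k = record
  { _~_ = Adj
  ; ~-sym = λ { (ne , f) → (λ e → ne (sym e)) , λ i → sw (f i) }
  ; ~-irrefl = λ { (ne , _) → ne refl }
  ; _~?_ = λ x y → ¬? (≡-dec _≟_ x y)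
                   ×-dec all? (λ i → (lookup x i ≟ lookup y i) ⊎-dec (_~?_ G (lookup x i) (lookup y i)))
  }
  where
  Adj : Vec V k → Vec V k → Set
  Adj x y = x ≢ y × (∀ i → lookup x i ≡ lookup y i ⊎ _~_ G (lookup x i) (lookup y i))
  sw : ∀ {a b} → a ≡ b ⊎ _~_ G a b → b ≡ a ⊎ _~_ G b a
  sw (inj₁ e) = inj₁ (sym e)
  sw (inj₂ e) = inj₂ (~-sym G e)

PathPower : (m k : ℕ) → Graph (Vec (Fin m) k)
PathPower m k = StrongPower _≟F_ (Path m) k

-- The subgraph of H induced by φ(V), transported back to V along the injection φ:
-- u ~ v iff φ u ~_H φ v.  Distances here are distances in φ(G).
Induced : {V W : Set} → Graph W → (V → W) → Graph V
Induced H φ = record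
  { _~_ = λ u v → _~_ H (φ u) (φ v)
  ; ~-sym = ~-sym H
  ; ~-irrefl = ~-irrefl H
  ; _~?_ = λ u v → _~?_ H (φ u) (φ v)
  }

IsEmbedding : {V W : Set} → Graph V → Graph W → (V → W) → Set
IsEmbedding G H φ = Injective _≡_ _≡_ φ × (∀ {u v} → _~_ G u v → _~_ H (φ u) (φ v))

IsResolvedEmbedding : ∀ {n} → Graph (Fin n) → (m : ℕ) → ∀ {k} → (Fin k → Fin n)
                      → (Fin n → Vec (Fin m) k) → Set
IsResolvedEmbedding G m {k} W φ =
  IsEmbedding G (PathPower m k) φ ×
  (∀ x i → Dist (Induced (PathPower m k) φ) x (W i) (toℕ (lookup (φ x) i)))

IsIsometricImage : ∀ {n} (m k : ℕ) → (Fin n → Vec (Fin m) k) → Set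
IsIsometricImage m k φ =
  ∀ x y d → Dist (Induced (PathPower m k) φ) x y d → Dist (PathPower m k) (φ x) (φ y) d

module Submission where

-- Both sides of the theorem are minima.  The heart of the proof is that for every k
--   (∃ H ⊇ G with a strong resolving set of size k)  ⇔  (∃ W of size k with a
--   W-resolved embedding φ of G in P_{D+1}^{⊠,k} such that φ(G) is isometric),
-- after which a general fact about minima of minima (min-of-mins) finishes the proof.

open import Defs
open import Data.Nat using (ℕ; zero; suc; _+_; _≤_; _<_; z≤n; s≤s; _≤?_)
open import Data.Nat.Properties
open import Data.Nat.Induction using (<-rec)
open import Data.Fin using (Fin; zero; suc; toℕ; fromℕ<; inject₁)
open import Data.Fin.Properties using (toℕ-fromℕ<; toℕ-injective; toℕ-inject₁; any?)
  renaming (_≟_ to _≟F_)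
open import Data.Vec using (Vec; lookup; tabulate)
open import Data.Vec.Properties using (lookup∘tabulate; tabulate∘lookup; tabulate-cong; ≡-dec)
open import Data.Product using (Σ; ∃; _×_; _,_; proj₁; proj₂; swap)
open import Data.Sum using (_⊎_; inj₁; inj₂)
open import Data.Empty using (⊥-elim)
open import Relation.Nullary using (¬_; Dec; yes; no)
open import Relation.Nullary.Decidable using (_×-dec_; _⊎-dec_; decidable-stable)
open import Relation.Binary.Definitions using (tri<; tri≈; tri>)
open import Relation.Binary.PropositionalEquality
  using (_≡_; _≢_; refl; sym; trans; cong; subst)
open import Function.Definitions using (Injective)
open import Function.Bundles using (_⇔_; mk⇔)

-- Minima of predicates on ℕ

-- A decidable predicate with a witness has a least witness: if some j < m also
-- satisfies P, recurse on it, otherwise m itself is least.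
least : ∀ {ℓ} {P : ℕ → Set ℓ} → (∀ j → Dec (P j)) → ∀ {m} → P m → Σ ℕ (IsMin P)
least {P = P} P? {m} = <-rec (λ m → P m → Σ ℕ (IsMin P)) search m
  where
  search : ∀ m → (∀ {j} → j < m → P j → Σ ℕ (IsMin P)) → P m → Σ ℕ (IsMin P)
  search m below pm with anyUpTo? P? m
  ... | yes (j , j<m , pj) = below j<m pj
  ... | no none = m , pm , λ k pk → ≮⇒≥ (λ k<m → none (k , k<m , pk))

-- Without decidability a least witness still exists in the double-negated sense:
-- if no minimum exists, strong induction shows P fails everywhere.
¬¬-least : ∀ {ℓ} {P : ℕ → Set ℓ} {m} → P m → ¬ ¬ Σ ℕ (IsMin P)
¬¬-least {P = P} {m} pm noMin = <-rec (λ j → ¬ P j) refute m pm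
  where
  refute : ∀ j → (∀ {k} → k < j → ¬ P k) → ¬ P j
  refute j below pj = noMin (j , pj , λ k pk → ≮⇒≥ (λ k<j → below k<j pk))

-- If Q k holds exactly when some admissible index i has P i k, then the minimum over
-- admissible i of the minimum of P i is the minimum of Q.  (The inner minima need not
-- exist constructively; ¬¬-least suffices because the comparison t ≤ k is decidable.)
min-of-mins : ∀ {a r p q} {I : Set a} (R : I → Set r) (P : I → ℕ → Set p)
  (Q : ℕ → Set q) → (∀ {k} → Q k → Σ I λ i → R i × P i k) →
  (∀ {i k} → R i → P i k → Q k) →
  ∀ t → IsMin (λ k → Σ I λ i → R i × IsMin (P i) k) t ⇔ IsMin Q t
min-of-mins {I = I} R P Q split join t = mk⇔ to from
  where
  to : IsMin (λ k → Σ I λ i → R i × IsMin (P i) k) t → IsMin Q t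
  to ((i , ri , pit , _) , minimal) = join ri pit , below
    where
    below : ∀ k → Q k → t ≤ k
    below k qk with split qk
    ... | j , rj , pjk = decidable-stable (t ≤? k) λ t≰k → ¬¬-least pjk λ
      { (b , isMin) → t≰k (≤-trans (minimal b (j , rj , isMin)) (proj₂ isMin k pjk)) }
  from : IsMin Q t → IsMin (λ k → Σ I λ i → R i × IsMin (P i) k) t
  from (qt , minimal) with split qt
  ... | i , ri , pit = (i , ri , pit , λ k pik → minimal k (join ri pik)) ,
                       λ { k (j , rj , pjk , _) → minimal k (join rj pjk) }

module _ {V : Set} (G : Graph V) where

  _++_ : ∀ {x y z a b} → Walk G x y a → Walk G y z b → Walk G x z (a + b)
  [] ++ q = q
  (e ∷ p) ++ q = e ∷ (p ++ q)

  ∈-++ : ∀ {x y z a b} (p : Walk G x y a) (q : Walk G y z b) → _∈W_ {G = G} y (p ++ q)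
  ∈-++ [] q = here
  ∈-++ (e ∷ p) q = there (∈-++ p q)

  reverse : ∀ {x y a} → Walk G x y a → Walk G y x a
  reverse [] = []
  reverse {a = suc a} (e ∷ p) = subst (Walk G _ _) (+-comm a 1) (reverse p ++ (~-sym G e ∷ []))

  walk0 : ∀ {x y} → Walk G x y 0 → x ≡ y
  walk0 [] = refl

  dist-sym : ∀ {x y d} → Dist G x y d → Dist G y x d
  dist-sym (p , minimal) = reverse p , λ m q → minimal m (reverse q)

  split-at : ∀ {x y z k} (p : Walk G x z k) → _∈W_ {G = G} y p →
             Σ ℕ λ a → Σ ℕ λ b → Walk G x y a × Walk G y z b × a + b ≡ k
  split-at {k = k} p here = 0 , k , [] , p , refl
  split-at (e ∷ p) (there y∈p) with split-at p y∈p
  ... | a , b , q , r , eq = suc a , b , e ∷ q , r , cong suc eq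

  through⇒sum : ∀ {u w v c b} → ShortestPathThrough G u w v → Dist G u w c → Dist G v w b →
                Σ ℕ λ a → Walk G u v a × a + b ≤ c
  through⇒sum (_ , p , minimal , v∈p) (puw , _) (_ , minimalVW) with split-at p v∈p
  ... | a , b' , q , r , eq =
    a , q , ≤-trans (+-monoʳ-≤ a (minimalVW b' r)) (≤-trans (≤-reflexive eq) (minimal _ puw))

  sum⇒through : ∀ {u v w a b c} → Dist G u v a → Dist G v w b → Dist G u w c → a + b ≤ c →
                ShortestPathThrough G u w v
  sum⇒through (p , _) (q , _) (_ , minimal) le =
    _ , p ++ q , (λ m r → ≤-trans le (minimal m r)) , ∈-++ p q

map-walk : ∀ {V} {G H : Graph V} → G ⊆G H → ∀ {x y m} → Walk G x y m → Walk H x y m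
map-walk sub [] = []
map-walk sub (e ∷ p) = sub e ∷ map-walk sub p

ambient-walk : ∀ {V U : Set} {H : Graph U} {φ : V → U} {x y m} →
           Walk (Induced H φ) x y m → Walk H (φ x) (φ y) m
ambient-walk [] = []
ambient-walk (e ∷ p) = e ∷ ambient-walk p

spanning-connected : ∀ {V} {G H : Graph V} → G ⊆G H → Connected G → Connected H
spanning-connected sub conn u v = proj₁ (conn u v) , map-walk sub (proj₂ (conn u v))

spanning-dist-≤ : ∀ {V} {G H : Graph V} → G ⊆G H → ∀ {x y a b} →
                  Dist G x y a → Dist H x y b → b ≤ a
spanning-dist-≤ sub (p , _) (_ , minimal) = minimal _ (map-walk sub p)

module _ {n : ℕ} (G : Graph (Fin n)) where

  -- Walks of a given length in a finite graph are decidable: search the first edge.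
  walk? : ∀ m x y → Dec (Walk G x y m)
  walk? zero x y with x ≟F y
  ... | yes refl = yes []
  ... | no x≢y = no λ p → x≢y (walk0 G p)
  walk? (suc m) x y with any? (λ z → _~?_ G x z ×-dec walk? m z y)
  ... | yes (z , e , p) = yes (e ∷ p)
  ... | no none = no λ { (e ∷ p) → none (_ , e , p) }

  distance : Connected G → ∀ x y → Σ ℕ (Dist G x y)
  distance conn x y = least (λ j → walk? j x y) (proj₂ (conn x y))

-- Arithmetic of coordinates: Near m x y means |x - y| ≤ m, Far d x y means |x - y| ≥ d.

Near : ℕ → ℕ → ℕ → Set
Near m x y = x ≤ m + y × y ≤ m + x

Far : ℕ → ℕ → ℕ → Set
Far d x y = d + y ≤ x ⊎ d + x ≤ y

near-sym : ∀ {m x y} → Near m x y → Near m y x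
near-sym = swap

near-trans : ∀ {m m' x y z} → Near m x y → Near m' y z → Near (m + m') x z
near-trans {m} {m'} {x} {y} {z} (x≤ , y≤) (y≤' , z≤) =
  ≤-trans x≤ (≤-trans (+-monoʳ-≤ m y≤') (≤-reflexive (sym (+-assoc m m' z)))) ,
  ≤-trans z≤ (≤-trans (+-monoʳ-≤ m' y≤) (≤-reflexive (trans (sym (+-assoc m' m x))
                                                              (cong (_+ x) (+-comm m' m)))))

near-self : ∀ m x → Near m x x
near-self m x = m≤n+m x m , m≤n+m x m

successor-near : ∀ {x y} → y ≡ suc x → Near 1 x y
successor-near {x} refl = m≤n+m x 2 , ≤-refl

near-zero : ∀ {x y} → Near 0 x y → x ≡ y
near-zero (x≤y , y≤x) = ≤-antisym x≤y y≤x

far-near : ∀ {d m x y} → Far d x y → Near m x y → d ≤ m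
far-near {d} {m} {x} {y} (inj₁ far) (x≤ , _) = +-cancelʳ-≤ y d m (≤-trans far x≤)
far-near {d} {m} {x} {y} (inj₂ far) (_ , y≤) = +-cancelʳ-≤ x d m (≤-trans far y≤)

near-adjacent : ∀ {N} {u v : Fin N} → Near 1 (toℕ u) (toℕ v) → u ≡ v ⊎ _~_ (Path N) u v
near-adjacent {u = u} {v} (u≤ , v≤) with <-cmp (toℕ u) (toℕ v)
... | tri< u<v _ _ = inj₂ (inj₁ (≤-antisym v≤ u<v))
... | tri≈ _ u≡v _ = inj₁ (toℕ-injective u≡v)
... | tri> _ _ v<u = inj₂ (inj₂ (≤-antisym u≤ v<u))

adjacent-near : ∀ {N} {u v : Fin N} → u ≡ v ⊎ _~_ (Path N) u v → Near 1 (toℕ u) (toℕ v)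
adjacent-near {u = u} (inj₁ refl) = near-self 1 (toℕ u)
adjacent-near (inj₂ (inj₁ e)) = successor-near e
adjacent-near (inj₂ (inj₂ e)) = near-sym (successor-near e)

-- The metric of P_N^{⊠,k}

data StepToward (x y s : ℕ) : Set where
  arrived : x ≡ y → s ≡ x → StepToward x y s
  up      : x < y → s ≡ suc x → StepToward x y s
  down    : y < x → x ≡ suc s → StepToward x y s

step-suc : ∀ {x y s} → StepToward x y s → StepToward (suc x) (suc y) (suc s)
step-suc (arrived e f) = arrived (cong suc e) (cong suc f)
step-suc (up lt e) = up (s≤s lt) (cong suc e)
step-suc (down lt e) = down (s≤s lt) (cong suc e)

towards : ∀ {N} → Fin N → Fin N → Fin N
towards zero zero = zero
towards zero (suc zero) = suc zero
towards zero (suc (suc y)) = suc zero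
towards (suc x) zero = inject₁ x
towards (suc x) (suc y) = suc (towards x y)

towards-step : ∀ {N} (x y : Fin N) → StepToward (toℕ x) (toℕ y) (toℕ (towards x y))
towards-step zero zero = arrived refl refl
towards-step zero (suc zero) = up (s≤s z≤n) refl
towards-step zero (suc (suc y)) = up (s≤s z≤n) refl
towards-step (suc x) zero = down (s≤s z≤n) (cong suc (sym (toℕ-inject₁ x)))
towards-step (suc x) (suc y) = step-suc (towards-step x y)

step-near₁ : ∀ {x y s} → StepToward x y s → Near 1 x s
step-near₁ {x} (arrived _ refl) = near-self 1 x
step-near₁ (up _ refl) = successor-near refl
step-near₁ (down _ refl) = near-sym (successor-near refl)

step-near : ∀ {m x y s} → StepToward x y s → Near (suc m) x y → Near m s y
step-near {m} {x} (arrived refl refl) _ = near-self m x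
step-near {m} {x} {y} (up x<y refl) (_ , y≤) =
  ≤-trans x<y (m≤n+m y m) , ≤-trans y≤ (≤-reflexive (sym (+-suc m x)))
step-near {m} {s = s} (down y<x refl) (x≤ , _) =
  m<1+n⇒m≤n x≤ , ≤-trans (m<1+n⇒m≤n y<x) (m≤n+m s m)

step-moves : ∀ {x y s} → StepToward x y s → s ≡ x → x ≡ y
step-moves (arrived e _) _ = e
step-moves (up _ refl) e = ⊥-elim (1+n≢n e)
step-moves (down _ refl) e = ⊥-elim (1+n≢n (sym e))

module _ {N k : ℕ} where

  private
    P : Graph (Vec (Fin N) k)
    P = PathPower N k

  coord : Vec (Fin N) k → Fin k → ℕ
  coord a i = toℕ (lookup a i)

  coord-ext : ∀ {a b : Vec (Fin N) k} → (∀ i → coord a i ≡ coord b i) → a ≡ b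
  coord-ext {a} {b} same = trans (sym (tabulate∘lookup a))
    (trans (tabulate-cong (λ i → toℕ-injective (same i))) (tabulate∘lookup b))

  walk-near : ∀ {a b m} → Walk P a b m → ∀ i → Near m (coord a i) (coord b i)
  walk-near [] i = near-self 0 _
  walk-near (e ∷ p) i = near-trans (adjacent-near (proj₂ e i)) (walk-near p i)

  step-vec : Vec (Fin N) k → Vec (Fin N) k → Vec (Fin N) k
  step-vec a b = tabulate λ i → towards (lookup a i) (lookup b i)

  step-vec-step : ∀ a b i → StepToward (coord a i) (coord b i) (coord (step-vec a b) i)
  step-vec-step a b i = subst (λ s → StepToward (coord a i) (coord b i) (toℕ s))
    (sym (lookup∘tabulate _ i)) (towards-step (lookup a i) (lookup b i))

  step-vec-edge : ∀ {a b} → a ≢ b → _~_ P a (step-vec a b)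
  step-vec-edge {a} {b} a≢b =
    (λ eq → a≢b (coord-ext λ i → step-moves (step-vec-step a b i) (sym (cong (λ v → coord v i) eq)))) ,
    λ i → near-adjacent (step-near₁ (step-vec-step a b i))

  near-walk : ∀ m (a b : Vec (Fin N) k) → (∀ i → Near m (coord a i) (coord b i)) →
              Σ ℕ λ j → j ≤ m × Walk P a b j
  near-walk m a b near with ≡-dec _≟F_ a b
  ... | yes refl = 0 , z≤n , []
  near-walk zero a b near | no a≢b = ⊥-elim (a≢b (coord-ext λ i → near-zero (near i)))
  near-walk (suc m) a b near | no a≢b
    with near-walk m (step-vec a b) b (λ i → step-near (step-vec-step a b i) (near i))
  ... | j , j≤m , p = suc j , s≤s j≤m , step-vec-edge a≢b ∷ p

  far-coordinate : ∀ {a b d} → Dist P a b (suc d) → ∃ λ i → Far (suc d) (coord a i) (coord b i)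
  far-coordinate {a} {b} {d} (_ , minimal)
    with any? (λ i → (suc d + coord b i ≤? coord a i) ⊎-dec (suc d + coord a i ≤? coord b i))
  ... | yes found = found
  ... | no none with near-walk d a b near
    where
    near : ∀ i → Near d (coord a i) (coord b i)
    near i = m<1+n⇒m≤n (≰⇒> λ le → none (i , inj₁ le)) ,
             m<1+n⇒m≤n (≰⇒> λ le → none (i , inj₂ le))
  ... | j , j≤d , p = ⊥-elim (<-irrefl refl (≤-trans (minimal j p) j≤d))

-- (⇐) From an isometric resolved embedding to a strong resolving set

-- If φ(G) is isometric in P_N^{⊠,k} and coordinate i of φ x is the distance from x to
-- W i in φ(G), then W strongly resolves φ(G): for u ≠ v some coordinate i differs by
-- d(u,v), i.e. d(u,v) + d(v,W i) ≤ d(u,W i) (or with u, v swapped).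
landmarks-resolve : ∀ {n N k} (φ : Fin n → Vec (Fin N) k) (W : Fin k → Fin n) →
  Connected (Induced (PathPower N k) φ) →
  (∀ x i → Dist (Induced (PathPower N k) φ) x (W i) (coord (φ x) i)) →
  IsIsometricImage N k φ → IsStrongResolvingSet (Induced (PathPower N k) φ) W
landmarks-resolve φ W conn resolved isometric u v u≢v with distance _ conn u v
... | zero , (p , _) = ⊥-elim (u≢v (walk0 _ p))
... | suc d , duv with far-coordinate (isometric u v (suc d) duv)
... | i , inj₁ far = i , inj₁ (sum⇒through _ duv (resolved v i) (resolved u i) far)
... | i , inj₂ far = i , inj₂ (sum⇒through _ (dist-sym _ duv) (resolved u i) (resolved v i) far)

-- (⇒) From a strong resolving set to an isometric resolved embedding

-- For a connected H with strong resolving set W and all distances below N, map each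
-- vertex to its vector of distances to W.
module DistanceEmbedding {n N k} (H : Graph (Fin n)) (conn : Connected H)
  (W : Fin k → Fin n) (resolving : IsStrongResolvingSet H W)
  (bounded : ∀ x y d → Dist H x y d → d < N) where

  δ : Fin n → Fin k → ℕ
  δ x i = proj₁ (distance H conn x (W i))

  δ-dist : ∀ x i → Dist H x (W i) (δ x i)
  δ-dist x i = proj₂ (distance H conn x (W i))

  φ : Fin n → Vec (Fin N) k
  φ x = tabulate λ i → fromℕ< (bounded x (W i) (δ x i) (δ-dist x i))

  coord-φ : ∀ x i → coord (φ x) i ≡ δ x i
  coord-φ x i = trans (cong toℕ (lookup∘tabulate _ i)) (toℕ-fromℕ< _)

  δ-near⇒coord-near : ∀ {m u v} i → Near m (δ u i) (δ v i) → Near m (coord (φ u) i) (coord (φ v) i)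
  δ-near⇒coord-near {u = u} {v} i rewrite coord-φ u i | coord-φ v i = λ near → near

  coord-near⇒δ-near : ∀ {m u v} i → Near m (coord (φ u) i) (coord (φ v) i) → Near m (δ u i) (δ v i)
  coord-near⇒δ-near {u = u} {v} i rewrite coord-φ u i | coord-φ v i = λ near → near

  separating-landmark : ∀ {u v} → u ≢ v →
    ∃ λ i → Σ ℕ λ a → Walk H u v a × Far a (δ u i) (δ v i)
  separating-landmark {u} {v} u≢v with resolving u v u≢v
  ... | i , inj₁ through with through⇒sum H through (δ-dist u i) (δ-dist v i)
  ...   | a , p , le = i , a , p , inj₁ le
  separating-landmark {u} {v} u≢v | i , inj₂ through
    with through⇒sum H through (δ-dist v i) (δ-dist u i)
  ...   | a , p , le = i , a , reverse H p , inj₂ le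

  φ-injective : Injective _≡_ _≡_ φ
  φ-injective {u} {v} φu≡φv with u ≟F v
  ... | yes u≡v = u≡v
  ... | no u≢v with separating-landmark u≢v
  ... | i , a , p , far with n≤0⇒n≡0 (far-near far (coord-near⇒δ-near i same))
    where
    same : Near 0 (coord (φ u) i) (coord (φ v) i)
    same = subst (λ w → Near 0 (coord (φ u) i) (coord w i)) φu≡φv (near-self 0 _)
  ... | refl = walk0 H p

  -- Distances to a landmark change by at most one along an edge, so edges of H become
  -- edges of the strong product.
  φ-edge : ∀ {u v} → _~_ H u v → _~_ (PathPower N k) (φ u) (φ v)
  φ-edge {u} {v} e = (λ eq → ~-irrefl H (subst (_~_ H u) (sym (φ-injective eq)) e)) ,
                     λ i → near-adjacent (δ-near⇒coord-near i (edge-near i))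
    where
    edge-near : ∀ i → Near 1 (δ u i) (δ v i)
    edge-near i = proj₂ (δ-dist u i) _ (e ∷ proj₁ (δ-dist v i)) ,
                  proj₂ (δ-dist v i) _ (~-sym H e ∷ proj₁ (δ-dist u i))

  private
    H' : Graph (Fin n)
    H' = Induced (PathPower N k) φ

  -- The image keeps all H-walks; its distances to W i are still δ, because a shorter
  -- walk in the product would change coordinate i by less than δ x i.
  φ-resolved : ∀ x i → Dist H' x (W i) (coord (φ x) i)
  φ-resolved x i = subst (Dist H' x (W i)) (sym (coord-φ x i))
                         (map-walk φ-edge (proj₁ (δ-dist x i)) , shortest)
    where
    landmark-zero : coord (φ (W i)) i ≡ 0
    landmark-zero = trans (coord-φ (W i) i) (n≤0⇒n≡0 (proj₂ (δ-dist (W i) i) 0 []))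
    shortest : ∀ m → Walk H' x (W i) m → δ x i ≤ m
    shortest m p = begin
      δ x i                  ≡⟨ sym (coord-φ x i) ⟩
      coord (φ x) i          ≤⟨ proj₁ (walk-near (ambient-walk p) i) ⟩
      m + coord (φ (W i)) i  ≡⟨ cong (m +_) landmark-zero ⟩
      m + 0                  ≡⟨ +-identityʳ m ⟩
      m                      ∎
      where open ≤-Reasoning

  -- Isometry: a product walk of length m between φ u and φ v changes the separating
  -- coordinate by at most m, which bounds a u-v walk of H, hence of φ(H).
  φ-isometric : IsIsometricImage N k φ
  φ-isometric u v d (p , minimal) = ambient-walk p , bound
    where
    bound : ∀ m → Walk (PathPower N k) (φ u) (φ v) m → d ≤ m
    bound m q with u ≟F v
    ... | yes refl = ≤-trans (minimal 0 []) z≤n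
    ... | no u≢v with separating-landmark u≢v
    ... | i , a , r , far = ≤-trans (minimal a (map-walk φ-edge r))
                                    (far-near far (coord-near⇒δ-near i (walk-near q i)))

module _ {n} (G : Graph (Fin n)) (D : ℕ) (conn : Connected G) (diam : IsDiameter G D) where

  ResolvableSupergraph : ℕ → Set₁
  ResolvableSupergraph k = Σ (Graph (Fin n)) λ H → G ⊆G H ×
    Σ (Fin k → Fin n) λ W → Injective _≡_ _≡_ W × IsStrongResolvingSet H W

  IsometricResolvedEmbedding : ℕ → Set
  IsometricResolvedEmbedding k = Σ (Fin k → Fin n) λ W → Injective _≡_ _≡_ W ×
    Σ (Fin n → Vec (Fin (suc D)) k) λ φ →
      IsResolvedEmbedding G (suc D) W φ × IsIsometricImage (suc D) k φ

  embedding⇒supergraph : ∀ {k} → IsometricResolvedEmbedding k → ResolvableSupergraph k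
  embedding⇒supergraph (W , W-inj , φ , ((_ , edges) , resolved) , isometric) =
    Induced (PathPower (suc D) _) φ , edges , W , W-inj ,
    landmarks-resolve φ W (spanning-connected edges conn) resolved isometric

  -- Distances in a spanning supergraph are at most those in G, hence at most D.
  supergraph⇒embedding : ∀ {k} → ResolvableSupergraph k → IsometricResolvedEmbedding k
  supergraph⇒embedding (H , sub , W , W-inj , resolving) =
    W , W-inj , φ , ((φ-injective , λ e → φ-edge (sub e)) , φ-resolved) , φ-isometric
    where
    bounded : ∀ x y d → Dist H x y d → d < suc D
    bounded x y d dH with distance G conn x y
    ... | _ , dG = s≤s (≤-trans (spanning-dist-≤ sub dG dH) (proj₂ diam x y _ dG))
    open DistanceEmbedding H (spanning-connected sub conn) W resolving bounded

corollary3p3 : ∀ {n} (G : Graph (Fin n)) (D : ℕ) → Connected G → IsDiameter G D →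
    ∀ t → ThresholdStrongDim G t ⇔
      IsMin (λ k → Σ (Fin k → Fin n) λ W → Injective _≡_ _≡_ W ×
               Σ (Fin n → Vec (Fin (suc D)) k) λ φ →
                 IsResolvedEmbedding G (suc D) W φ × IsIsometricImage (suc D) k φ) t
corollary3p3 {n} G D conn diam =
  min-of-mins (G ⊆G_) (λ H k → Σ (Fin k → Fin n) λ W → Injective _≡_ _≡_ W × IsStrongResolvingSet H W)
    (IsometricResolvedEmbedding G D conn diam)
    (embedding⇒supergraph G D conn diam)
    (λ sub srs → supergraph⇒embedding G D conn diam (_ , sub , srs))
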